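{- Every cycle $C_{2\ell}$ of length $2\ell=8$ or $2\ell\geq 12$ has an induced three-partite or two-partite representation in the hypercube.
   Context: Identify the vertices of $Q_n$ with subsets of $[n]$, adjacent iff their symmetric difference has size $1$; the $k$-th vertex layer is $\binom{[n]}{k}$. A down $k$-star is a vertex $X$ of the $k$-th vertex layer together with its $k$ edges to the $(k-1)$-th vertex layer. For a set $A$ of vertices of the $k$-th vertex layer, $\mathcal H_A$ is the $k$-uniform hypergraph on $[n]$ whose edges are the members of $A$. A graph $G$ has an induced $k$-partite representation if there are $n$ and a set $A$ of vertices of the $k$-th vertex layer of $Q_n$ such that $\mathcal H_A$ is $k$-partite (vertex set split into $k$ parts with every edge meeting each part in exactly one vertex) and $G$ is isomorphic to a subgraph $G'$ of the union of the down $k$-stars centered at vertices of $A$, where $G'$ is an induced subgraph of $Q_n$. -}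

module Defs where

open import Data.Nat using (ℕ; suc; _+_)
open import Data.Fin using (Fin; toℕ)
open import Data.Fin.Subset using (Subset; _∈_; _⊆_; _∪_; _─_; ∣_∣)
open import Data.Product using (Σ; ∃; ∃-syntax; _×_)
open import Data.Sum using (_⊎_)
open import Relation.Binary.PropositionalEquality using (_≡_)
open import Function.Definitions using (Injective)

-- Vertices of Q_n are subsets of [n] = Fin n.
-- Symmetric difference of two subsets.
_△_ : ∀ {n} → Subset n → Subset n → Subset n
X △ Y = (X ─ Y) ∪ (Y ─ X)

QAdj : ∀ {n} → Subset n → Subset n → Set
QAdj X Y = ∣ X △ Y ∣ ≡ 1

InLayer : ∀ {n} → ℕ → (Subset n → Set) → Set
InLayer k A = ∀ X → A X → ∣ X ∣ ≡ k

-- H_A is k-partite: a partition of [n] into k parts (colouring c) such that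
-- every edge of H_A meets every part in exactly one vertex.
IsKPartite : ∀ {n} → ℕ → (Subset n → Set) → Set
IsKPartite {n} k A =
  Σ (Fin n → Fin k) λ c → ∀ X → A X → ∀ (j : Fin k) →
    ∃[ x ] (x ∈ X × c x ≡ j × (∀ y → y ∈ X → c y ≡ j → y ≡ x))

StarVertex : ∀ {n} → ℕ → (Subset n → Set) → Subset n → Set
StarVertex k A Y = A Y ⊎ (∃[ X ] (A X × Y ⊆ X × suc ∣ Y ∣ ≡ k))

StarEdge : ∀ {n} → ℕ → (Subset n → Set) → Subset n → Subset n → Set
StarEdge k A X Y = A X × Y ⊆ X × suc ∣ Y ∣ ≡ k × QAdj X Y

-- A graph G on vertex set Fin m (adjacency relation Adj) has an induced
-- k-partite representation: there are n and A in layer k of Q_n with H_A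
-- k-partite, and an injective map f : Fin m → Subset n whose image G'
-- (with G's edges transported) is a subgraph of the union of down k-stars
-- which is an induced subgraph of Q_n.
HasInducedRep : ℕ → (m : ℕ) → (Fin m → Fin m → Set) → Set₁
HasInducedRep k m Adj =
  Σ ℕ λ n → Σ (Subset n → Set) λ A →
    InLayer k A × IsKPartite k A ×
    Σ (Fin m → Subset n) λ f →
      Injective _≡_ _≡_ f ×
      (∀ i → StarVertex k A (f i)) ×
      (∀ i j → Adj i j → StarEdge k A (f i) (f j) ⊎ StarEdge k A (f j) (f i)) ×
      -- G' is induced in Q_n: every Q_n edge among its vertices is an edge of G'
      (∀ i j → QAdj (f i) (f j) → Adj i j)

CycleAdj : (m : ℕ) → Fin m → Fin m → Set
CycleAdj m i j = Succ i j ⊎ Succ j i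
  where
  Succ : Fin m → Fin m → Set
  Succ a b = (toℕ b ≡ suc (toℕ a)) ⊎ (suc (toℕ a) ≡ m × toℕ b ≡ 0)

-- A 2ℓ-cycle is realised by a zigzag X₀ ⊃ Y₀ ⊂ X₁ ⊃ Y₁ ⊂ ⋯ ⊃ Y_{ℓ-1} ⊂ X₀ of 3-sets X_t and
-- 2-sets Y_t ⊆ X_t ∩ X_{t+1}, in which no Y_s lies in any other X_t. Sets of equal size are
-- never adjacent in Q_n, and a 2-set is adjacent to a 3-set exactly when it is contained in
-- it, so the zigzag is an induced cycle; it lies in the down-stars of the X_t, and H_A is
-- 3-partite as soon as a 3-colouring of [n] makes every X_t rainbow.
-- For even ℓ ≥ 4 take the wheel: triangles {hub, r, r+1} around a rim cycle of length ℓ,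
-- the rim coloured by parity. For odd ℓ ≥ 7 take the wheel with rim of even length ℓ − 3 and
-- replace one of its triangles by a strip of four triangles around a second hub.

module Submission where

open import Defs
open import Data.Bool using (Bool; T; _∧_; _∨_)
open import Data.Bool.Properties using (T-∧; T-∨)
open import Data.Nat
  using (ℕ; zero; suc; _+_; _*_; _≤_; _<_; s≤s; z≤n; _≡ᵇ_; _<ᵇ_; NonZero; parity)
open import Data.Nat.Properties
  using (+-identityʳ; +-suc; *-suc; +-cancelʳ-≡; suc-injective; 1+n≢n; *-cancelˡ-≡;
         *-cancelˡ-≤; *-cancelˡ-<; even≢odd; <⇒≤; <⇒≢; n<1+n; m<n⇒m<1+n;
         ≡ᵇ⇒≡; ≡⇒≡ᵇ; <ᵇ⇒<; <⇒<ᵇ; m≤n⇒∃[o]m+o≡n)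
open import Data.Nat.DivMod using (_mod_; m<n⇒m%n≡m)
open import Data.Parity.Base using (Parity; 0ℙ; 1ℙ)
open import Data.Parity.Properties using (suc-homo-⁻¹; ⁻¹-selfInverse; p≢p⁻¹)
open import Data.Fin as Fin using (Fin; toℕ; #_)
open import Data.Fin.Properties using (toℕ-injective; toℕ<n; toℕ-fromℕ<)
open import Data.Fin.Subset
  using (Subset; inside; outside; ⁅_⁆; _∪_; _∩_; _─_; _∈_; _∉_; _⊆_; ∣_∣)
open import Data.Fin.Subset.Properties
  using (_∈?_; ∪-comm; ∪-identityˡ; ⊆-antisym; p∩q⊆q; x∈p∩q⁺; x∈p∩q⁻; p⊂q⇒∣p∣<∣q∣;
         x∈p∪q⁻; x∈p∪q⁺; x∈⁅x⁆; x∈⁅y⁆⇒x≡y; x≢y⇒x∉⁅y⁆; ∣⁅x⁆∣≡1; ∣p∣≡n⇒p≡⊤; ∈⊤)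
open import Data.Vec using (_∷_; []; here; there)
open import Data.Product using (_×_; _,_; proj₁; proj₂; ∃-syntax)
open import Data.Sum using (_⊎_; inj₁; inj₂; [_,_]; swap)
import Data.Sum as Sum
open import Data.Empty using (⊥-elim)
open import Function using (_∘_; Equivalence)
open import Relation.Nullary using (¬_; yes; no; contradiction)
open import Relation.Binary.PropositionalEquality
  using (_≡_; _≢_; refl; sym; trans; cong; subst; subst₂; module ≡-Reasoning)

open Equivalence using (to; from)

private
  variable
    n ℓ s t u i j : ℕ
    p q : Subset n
    a b c x : Fin n

-- Adjacency in Q_n between sets of equal or consecutive sizes

△-comm : (p q : Subset n) → p △ q ≡ q △ p
△-comm p q = ∪-comm (p ─ q) (q ─ p)

QAdj-sym : (p q : Subset n) → QAdj p q → QAdj q p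
QAdj-sym p q = trans (cong ∣_∣ (△-comm q p))

∣p△q∣+2∣p∩q∣≡∣p∣+∣q∣ : (p q : Subset n) → ∣ p △ q ∣ + 2 * ∣ p ∩ q ∣ ≡ ∣ p ∣ + ∣ q ∣
∣p△q∣+2∣p∩q∣≡∣p∣+∣q∣ []            []            = refl
∣p△q∣+2∣p∩q∣≡∣p∣+∣q∣ (outside ∷ p) (outside ∷ q) = ∣p△q∣+2∣p∩q∣≡∣p∣+∣q∣ p q
∣p△q∣+2∣p∩q∣≡∣p∣+∣q∣ (inside  ∷ p) (outside ∷ q) = cong suc (∣p△q∣+2∣p∩q∣≡∣p∣+∣q∣ p q)
∣p△q∣+2∣p∩q∣≡∣p∣+∣q∣ (outside ∷ p) (inside  ∷ q) =
  trans (cong suc (∣p△q∣+2∣p∩q∣≡∣p∣+∣q∣ p q)) (sym (+-suc ∣ p ∣ ∣ q ∣))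
∣p△q∣+2∣p∩q∣≡∣p∣+∣q∣ (inside  ∷ p) (inside  ∷ q) = begin
  ∣ p △ q ∣ + 2 * suc ∣ p ∩ q ∣           ≡⟨ cong (∣ p △ q ∣ +_) (*-suc 2 ∣ p ∩ q ∣) ⟩
  ∣ p △ q ∣ + suc (suc (2 * ∣ p ∩ q ∣))   ≡⟨ +-suc ∣ p △ q ∣ _ ⟩
  suc (∣ p △ q ∣ + suc (2 * ∣ p ∩ q ∣))   ≡⟨ cong suc (+-suc ∣ p △ q ∣ _) ⟩
  suc (suc (∣ p △ q ∣ + 2 * ∣ p ∩ q ∣))   ≡⟨ cong (2 +_) (∣p△q∣+2∣p∩q∣≡∣p∣+∣q∣ p q) ⟩
  suc (suc (∣ p ∣ + ∣ q ∣))               ≡⟨ cong suc (+-suc ∣ p ∣ ∣ q ∣) ⟨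
  suc ∣ p ∣ + suc ∣ q ∣                   ∎
  where open ≡-Reasoning

private
  m+m≡2*m : ∀ m → m + m ≡ 2 * m
  m+m≡2*m m = cong (m +_) (sym (+-identityʳ m))

  ∣p△q∣+2∣p∩q∣≡1+2∣q∣ : ∣ p ∣ ≡ suc ∣ q ∣ → ∣ p △ q ∣ + 2 * ∣ p ∩ q ∣ ≡ suc (2 * ∣ q ∣)
  ∣p△q∣+2∣p∩q∣≡1+2∣q∣ {p = p} {q} ∣p∣≡1+∣q∣ = begin
    ∣ p △ q ∣ + 2 * ∣ p ∩ q ∣   ≡⟨ ∣p△q∣+2∣p∩q∣≡∣p∣+∣q∣ p q ⟩
    ∣ p ∣ + ∣ q ∣               ≡⟨ cong (_+ ∣ q ∣) ∣p∣≡1+∣q∣ ⟩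
    suc (∣ q ∣ + ∣ q ∣)         ≡⟨ cong suc (m+m≡2*m ∣ q ∣) ⟩
    suc (2 * ∣ q ∣)             ∎
    where open ≡-Reasoning

same-size⇒¬QAdj : ∣ p ∣ ≡ ∣ q ∣ → ¬ QAdj p q
same-size⇒¬QAdj {p = p} {q} ∣p∣≡∣q∣ adj = even≢odd ∣ p ∣ ∣ p ∩ q ∣ (begin
  2 * ∣ p ∣                   ≡⟨ m+m≡2*m ∣ p ∣ ⟨
  ∣ p ∣ + ∣ p ∣               ≡⟨ cong (∣ p ∣ +_) ∣p∣≡∣q∣ ⟩
  ∣ p ∣ + ∣ q ∣               ≡⟨ ∣p△q∣+2∣p∩q∣≡∣p∣+∣q∣ p q ⟨
  ∣ p △ q ∣ + 2 * ∣ p ∩ q ∣   ≡⟨ cong (_+ 2 * ∣ p ∩ q ∣) adj ⟩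
  suc (2 * ∣ p ∩ q ∣)         ∎)
  where open ≡-Reasoning

⊆∧∣≡∣⇒⊇ : p ⊆ q → ∣ p ∣ ≡ ∣ q ∣ → q ⊆ p
⊆∧∣≡∣⇒⊇ {p = p} p⊆q ∣p∣≡∣q∣ {x} x∈q with x ∈? p
... | yes x∈p = x∈p
... | no  x∉p = contradiction ∣p∣≡∣q∣ (<⇒≢ (p⊂q⇒∣p∣<∣q∣ (p⊆q , x , x∈q , x∉p)))

QAdj⇒⊆ : ∣ p ∣ ≡ suc ∣ q ∣ → QAdj p q → q ⊆ p
QAdj⇒⊆ {p = p} {q} ∣p∣≡1+∣q∣ adj = proj₁ ∘ x∈p∩q⁻ p q ∘ ⊆∧∣≡∣⇒⊇ (p∩q⊆q p q) ∣p∩q∣≡∣q∣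
  where
  ∣p∩q∣≡∣q∣ : ∣ p ∩ q ∣ ≡ ∣ q ∣
  ∣p∩q∣≡∣q∣ = *-cancelˡ-≡ _ _ 2 (suc-injective
    (trans (cong (_+ 2 * ∣ p ∩ q ∣) (sym adj)) (∣p△q∣+2∣p∩q∣≡1+2∣q∣ {p = p} {q} ∣p∣≡1+∣q∣)))

⊆⇒QAdj : ∣ p ∣ ≡ suc ∣ q ∣ → q ⊆ p → QAdj p q
⊆⇒QAdj {p = p} {q} ∣p∣≡1+∣q∣ q⊆p = +-cancelʳ-≡ (2 * ∣ q ∣) ∣ p △ q ∣ 1
  (trans (cong (λ r → ∣ p △ q ∣ + 2 * ∣ r ∣) (sym p∩q≡q))
         (∣p△q∣+2∣p∩q∣≡1+2∣q∣ {p = p} {q} ∣p∣≡1+∣q∣))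
  where
  p∩q≡q : p ∩ q ≡ q
  p∩q≡q = ⊆-antisym (p∩q⊆q p q) (λ x∈q → x∈p∩q⁺ (q⊆p x∈q , x∈q))

-- Pairs, triples and rainbow sets

pair : Fin n → Fin n → Subset n
pair a b = ⁅ a ⁆ ∪ ⁅ b ⁆

triple : Fin n → Fin n → Fin n → Subset n
triple a b c = ⁅ a ⁆ ∪ pair b c

∈-pair⁻ : x ∈ pair a b → x ≡ a ⊎ x ≡ b
∈-pair⁻ {a = a} {b} = Sum.map (x∈⁅y⁆⇒x≡y a) (x∈⁅y⁆⇒x≡y b) ∘ x∈p∪q⁻ ⁅ a ⁆ ⁅ b ⁆

∈-pair⁺ : x ≡ a ⊎ x ≡ b → x ∈ pair a b
∈-pair⁺ (inj₁ refl) = x∈p∪q⁺ (inj₁ (x∈⁅x⁆ _))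
∈-pair⁺ (inj₂ refl) = x∈p∪q⁺ (inj₂ (x∈⁅x⁆ _))

∈-triple⁻ : x ∈ triple a b c → x ≡ a ⊎ x ≡ b ⊎ x ≡ c
∈-triple⁻ {a = a} {b} {c} = Sum.map (x∈⁅y⁆⇒x≡y a) ∈-pair⁻ ∘ x∈p∪q⁻ ⁅ a ⁆ (pair b c)

∈-triple⁺ : x ≡ a ⊎ x ≡ b ⊎ x ≡ c → x ∈ triple a b c
∈-triple⁺ (inj₁ refl) = x∈p∪q⁺ (inj₁ (x∈⁅x⁆ _))
∈-triple⁺ (inj₂ x∈bc) = x∈p∪q⁺ (inj₂ (∈-pair⁺ x∈bc))

∣⁅x⁆∪p∣≡1+∣p∣ : x ∉ p → ∣ ⁅ x ⁆ ∪ p ∣ ≡ suc ∣ p ∣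
∣⁅x⁆∪p∣≡1+∣p∣ {x = Fin.zero}  {p = outside ∷ p} _   = cong (suc ∘ ∣_∣) (∪-identityˡ p)
∣⁅x⁆∪p∣≡1+∣p∣ {x = Fin.zero}  {p = inside  ∷ p} x∉p = contradiction here x∉p
∣⁅x⁆∪p∣≡1+∣p∣ {x = Fin.suc x} {p = outside ∷ p} x∉p = ∣⁅x⁆∪p∣≡1+∣p∣ (x∉p ∘ there)
∣⁅x⁆∪p∣≡1+∣p∣ {x = Fin.suc x} {p = inside  ∷ p} x∉p = cong suc (∣⁅x⁆∪p∣≡1+∣p∣ (x∉p ∘ there))

Distinct₃ : {A : Set} → A → A → A → Set
Distinct₃ a b c = a ≢ b × a ≢ c × b ≢ c

Distinct₃-preimage : {A B : Set} (f : A → B) {a b c : A} →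
                     Distinct₃ (f a) (f b) (f c) → Distinct₃ a b c
Distinct₃-preimage f (fa≢fb , fa≢fc , fb≢fc) = fa≢fb ∘ cong f , fa≢fc ∘ cong f , fb≢fc ∘ cong f

∣pair∣≡2 : a ≢ b → ∣ pair a b ∣ ≡ 2
∣pair∣≡2 {b = b} a≢b = trans (∣⁅x⁆∪p∣≡1+∣p∣ (x≢y⇒x∉⁅y⁆ a≢b)) (cong suc (∣⁅x⁆∣≡1 b))

∣triple∣≡3 : Distinct₃ a b c → ∣ triple a b c ∣ ≡ 3
∣triple∣≡3 (a≢b , a≢c , b≢c) =
  trans (∣⁅x⁆∪p∣≡1+∣p∣ ([ a≢b , a≢c ] ∘ ∈-pair⁻)) (cong suc (∣pair∣≡2 b≢c))

Rainbow : ∀ {k} → (Fin n → Fin k) → Subset n → Set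
Rainbow colour X = ∀ j → ∃[ x ] (x ∈ X × colour x ≡ j × (∀ y → y ∈ X → colour y ≡ j → y ≡ x))

bijective⇒Rainbow : ∀ {k} {colour : Fin n → Fin k} {X} →
                    (∀ j → ∃[ x ] (x ∈ X × colour x ≡ j)) →
                    (∀ {x y} → x ∈ X → y ∈ X → colour x ≡ colour y → x ≡ y) →
                    Rainbow colour X
bijective⇒Rainbow onto injective j with onto j
... | x , x∈X , refl = x , x∈X , refl , λ y y∈X cy≡cx → injective y∈X x∈X cy≡cx

triple-rainbow : (colour : Fin n → Fin 3) →
                 Distinct₃ (colour a) (colour b) (colour c) → Rainbow colour (triple a b c)
triple-rainbow {a = a} {b} {c} colour distinct@(ab , ac , bc) = bijective⇒Rainbow onto injective
  where
  -- three distinct colours fill up Fin 3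
  onto : ∀ j → ∃[ x ] (x ∈ triple a b c × colour x ≡ j)
  onto j with ∈-triple⁻ {a = colour a} {colour b} {colour c}
                (subst (j ∈_) (sym (∣p∣≡n⇒p≡⊤ (∣triple∣≡3 distinct))) ∈⊤)
  ... | inj₁ refl        = a , ∈-triple⁺ (inj₁ refl) , refl
  ... | inj₂ (inj₁ refl) = b , ∈-triple⁺ (inj₂ (inj₁ refl)) , refl
  ... | inj₂ (inj₂ refl) = c , ∈-triple⁺ (inj₂ (inj₂ refl)) , refl

  same-colour : ∀ {x y} → x ≡ a ⊎ x ≡ b ⊎ x ≡ c → y ≡ a ⊎ y ≡ b ⊎ y ≡ c →
                colour x ≡ colour y → x ≡ y
  same-colour (inj₁ refl)        (inj₁ refl)        _ = refl
  same-colour (inj₂ (inj₁ refl)) (inj₂ (inj₁ refl)) _ = refl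
  same-colour (inj₂ (inj₂ refl)) (inj₂ (inj₂ refl)) _ = refl
  same-colour (inj₁ refl)        (inj₂ (inj₁ refl)) e = contradiction e ab
  same-colour (inj₁ refl)        (inj₂ (inj₂ refl)) e = contradiction e ac
  same-colour (inj₂ (inj₁ refl)) (inj₂ (inj₂ refl)) e = contradiction e bc
  same-colour (inj₂ (inj₁ refl)) (inj₁ refl)        e = contradiction (sym e) ab
  same-colour (inj₂ (inj₂ refl)) (inj₁ refl)        e = contradiction (sym e) ac
  same-colour (inj₂ (inj₂ refl)) (inj₂ (inj₁ refl)) e = contradiction (sym e) bc

  injective : ∀ {x y} → x ∈ triple a b c → y ∈ triple a b c → colour x ≡ colour y → x ≡ y
  injective x∈ y∈ = same-colour (∈-triple⁻ x∈) (∈-triple⁻ y∈)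

-- Cyclic successor and interleaving

-- CycleAdj m i j unfolds to Adjacent m (toℕ i) (toℕ j).
Next : ℕ → ℕ → ℕ → Set
Next m a b = b ≡ suc a ⊎ (suc a ≡ m × b ≡ 0)

Adjacent : ℕ → ℕ → ℕ → Set
Adjacent m a b = Next m a b ⊎ Next m b a

SameOrNext : ℕ → ℕ → ℕ → Set
SameOrNext m a b = b ≡ a ⊎ Next m a b

Next-asym : 3 ≤ ℓ → Next ℓ s t → ¬ Next ℓ t s
Next-asym (s≤s (s≤s (s≤s _))) (inj₁ refl)          (inj₁ s≡2+s) = <⇒≢ (m<n⇒m<1+n (n<1+n _)) s≡2+s
Next-asym (s≤s (s≤s (s≤s _))) (inj₁ refl)          (inj₂ (() , refl))
Next-asym (s≤s (s≤s (s≤s _))) (inj₂ (refl , refl)) (inj₁ ())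
Next-asym (s≤s (s≤s (s≤s _))) (inj₂ (refl , refl)) (inj₂ (() , _))

SameOrNext-antisym : 3 ≤ ℓ → SameOrNext ℓ s t → SameOrNext ℓ t s → s ≡ t
SameOrNext-antisym _   (inj₁ t≡s) _          = sym t≡s
SameOrNext-antisym _   _          (inj₁ s≡t) = s≡t
SameOrNext-antisym 3≤ℓ (inj₂ s→t) (inj₂ t→s) = contradiction t→s (Next-asym 3≤ℓ s→t)

Next-from-even : Next (2 * ℓ) (2 * t) j → j ≡ suc (2 * t)
Next-from-even         (inj₁ j≡1+2t)        = j≡1+2t
Next-from-even {ℓ} {t} (inj₂ (1+2t≡2ℓ , _)) = contradiction (sym 1+2t≡2ℓ) (even≢odd ℓ t)

Next-from-odd : Next (2 * ℓ) (suc (2 * s)) j → ∃[ t ] (j ≡ 2 * t × Next ℓ s t)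
Next-from-odd {s = s} (inj₁ refl)              = suc s , sym (*-suc 2 s) , inj₁ refl
Next-from-odd {s = s} (inj₂ (2+2s≡2ℓ , refl)) =
  0 , refl , inj₂ (*-cancelˡ-≡ _ _ 2 (trans (*-suc 2 s) 2+2s≡2ℓ) , refl)

Next-to-odd : Next ℓ s t → Next (2 * ℓ) (suc (2 * s)) (2 * t)
Next-to-odd {s = s} (inj₁ refl)          = inj₁ (*-suc 2 s)
Next-to-odd {s = s} (inj₂ (refl , refl)) = inj₂ (sym (*-suc 2 s) , refl)

interleave : {A : Set} → (ℕ → A) → (ℕ → A) → ℕ → A
interleave f g zero    = f zero
interleave f g (suc i) = interleave g (f ∘ suc) i

interleave-even : {A : Set} (f g : ℕ → A) (t : ℕ) → interleave f g (2 * t) ≡ f t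
interleave-even f g zero    = refl
interleave-even f g (suc t) =
  trans (cong (interleave f g) (*-suc 2 t)) (interleave-even (f ∘ suc) (g ∘ suc) t)

interleave-odd : {A : Set} (f g : ℕ → A) (t : ℕ) → interleave f g (suc (2 * t)) ≡ g t
interleave-odd f g = interleave-even g (f ∘ suc)

data Half : ℕ → Set where
  even : ∀ t → Half (2 * t)
  odd  : ∀ t → Half (suc (2 * t))

half : ∀ i → Half i
half zero = even 0
half (suc i) with half i
... | even t = odd t
... | odd  t = subst Half (*-suc 2 t) (even (suc t))

data Position (ℓ : ℕ) : ℕ → Set where
  even : t < ℓ → Position ℓ (2 * t)
  odd  : s < ℓ → Position ℓ (suc (2 * s))

position : i < 2 * ℓ → Position ℓ i
position {i} {ℓ} i<2ℓ with half i
... | even t = even (*-cancelˡ-< 2 t ℓ i<2ℓ)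
... | odd  s = odd  (*-cancelˡ-< 2 s ℓ (<⇒≤ i<2ℓ))

record Zigzag (k ℓ n : ℕ) : Set where
  field
    X Y       : ℕ → Subset n
    colouring : Fin n → Fin k
    ∣X∣≡k     : t < ℓ → ∣ X t ∣ ≡ k
    1+∣Y∣≡k   : s < ℓ → suc ∣ Y s ∣ ≡ k
    X-rainbow : t < ℓ → Rainbow colouring (X t)
    Y⊆X       : s < ℓ → Y s ⊆ X s
    Y⊆X-next  : s < ℓ → Next ℓ s t → Y s ⊆ X t
    Y⊆X⇒      : s < ℓ → t < ℓ → Y s ⊆ X t → SameOrNext ℓ s t

module _ {k ℓ n} (Z : Zigzag k ℓ n) (3≤ℓ : 3 ≤ ℓ) where
  open Zigzag Z

  IsCentre : Subset n → Set
  IsCentre S = ∃[ t ] (t < ℓ × S ≡ X t)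

  Linked : Subset n → Subset n → Set
  Linked P Q = StarEdge k IsCentre P Q ⊎ StarEdge k IsCentre Q P

  cycleVertex : ℕ → Subset n
  cycleVertex = interleave X Y

  cycleVertex-even : ∀ t → cycleVertex (2 * t) ≡ X t
  cycleVertex-even = interleave-even X Y

  cycleVertex-odd : ∀ s → cycleVertex (suc (2 * s)) ≡ Y s
  cycleVertex-odd = interleave-odd X Y

  ∣X∣≡1+∣Y∣ : t < ℓ → s < ℓ → ∣ X t ∣ ≡ suc ∣ Y s ∣
  ∣X∣≡1+∣Y∣ t<ℓ s<ℓ = trans (∣X∣≡k t<ℓ) (sym (1+∣Y∣≡k s<ℓ))

  X-injective : t < ℓ → u < ℓ → X t ≡ X u → t ≡ u
  X-injective {t} {u} t<ℓ u<ℓ Xt≡Xu = SameOrNext-antisym 3≤ℓ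
    (Y⊆X⇒ t<ℓ u<ℓ (subst (Y t ⊆_) Xt≡Xu (Y⊆X t<ℓ)))
    (Y⊆X⇒ u<ℓ t<ℓ (subst (Y u ⊆_) (sym Xt≡Xu) (Y⊆X u<ℓ)))

  Y-injective : s < ℓ → u < ℓ → Y s ≡ Y u → s ≡ u
  Y-injective {s} {u} s<ℓ u<ℓ Ys≡Yu = SameOrNext-antisym 3≤ℓ
    (Y⊆X⇒ s<ℓ u<ℓ (subst (_⊆ X u) (sym Ys≡Yu) (Y⊆X u<ℓ)))
    (Y⊆X⇒ u<ℓ s<ℓ (subst (_⊆ X s) Ys≡Yu (Y⊆X s<ℓ)))

  X≢Y : t < ℓ → s < ℓ → X t ≢ Y s
  X≢Y t<ℓ s<ℓ Xt≡Ys = 1+n≢n (trans (sym (∣X∣≡1+∣Y∣ t<ℓ s<ℓ)) (cong ∣_∣ Xt≡Ys))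

  star-edge : s < ℓ → t < ℓ → Y s ⊆ X t → StarEdge k IsCentre (X t) (Y s)
  star-edge s<ℓ t<ℓ Ys⊆Xt =
    (_ , t<ℓ , refl) , Ys⊆Xt , 1+∣Y∣≡k s<ℓ , ⊆⇒QAdj (∣X∣≡1+∣Y∣ t<ℓ s<ℓ) Ys⊆Xt

  QAdj⇒Adjacent : t < ℓ → s < ℓ → QAdj (X t) (Y s) → Adjacent (2 * ℓ) (2 * t) (suc (2 * s))
  QAdj⇒Adjacent t<ℓ s<ℓ adj with Y⊆X⇒ s<ℓ t<ℓ (QAdj⇒⊆ (∣X∣≡1+∣Y∣ t<ℓ s<ℓ) adj)
  ... | inj₁ refl = inj₁ (inj₁ refl)
  ... | inj₂ s→t  = inj₂ (Next-to-odd s→t)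

  cycleVertex-star : i < 2 * ℓ → StarVertex k IsCentre (cycleVertex i)
  cycleVertex-star i<2ℓ with position {ℓ = ℓ} i<2ℓ
  ... | even {t} t<ℓ = subst (StarVertex k IsCentre) (sym (cycleVertex-even t))
    (inj₁ (t , t<ℓ , refl))
  ... | odd  {s} s<ℓ = subst (StarVertex k IsCentre) (sym (cycleVertex-odd s))
    (inj₂ (X s , (s , s<ℓ , refl) , Y⊆X s<ℓ , 1+∣Y∣≡k s<ℓ))

  cycleVertex-injective : i < 2 * ℓ → j < 2 * ℓ → cycleVertex i ≡ cycleVertex j → i ≡ j
  cycleVertex-injective i<2ℓ j<2ℓ eq with position {ℓ = ℓ} i<2ℓ | position {ℓ = ℓ} j<2ℓ
  ... | even {t} t<ℓ | even {u} u<ℓ =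
    cong (2 *_) (X-injective t<ℓ u<ℓ (subst₂ _≡_ (cycleVertex-even t) (cycleVertex-even u) eq))
  ... | odd  {s} s<ℓ | odd  {u} u<ℓ =
    cong (suc ∘ (2 *_)) (Y-injective s<ℓ u<ℓ (subst₂ _≡_ (cycleVertex-odd s) (cycleVertex-odd u) eq))
  ... | even {t} t<ℓ | odd  {u} u<ℓ =
    ⊥-elim (X≢Y t<ℓ u<ℓ (subst₂ _≡_ (cycleVertex-even t) (cycleVertex-odd u) eq))
  ... | odd  {s} s<ℓ | even {u} u<ℓ =
    ⊥-elim (X≢Y u<ℓ s<ℓ (subst₂ _≡_ (cycleVertex-even u) (cycleVertex-odd s) (sym eq)))

  cycleVertex-linked : i < 2 * ℓ → j < 2 * ℓ → Next (2 * ℓ) i j →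
                       Linked (cycleVertex i) (cycleVertex j)
  cycleVertex-linked i<2ℓ j<2ℓ next with position {ℓ = ℓ} i<2ℓ
  ... | even {t} t<ℓ with refl ← Next-from-even {ℓ} {t} next =
    subst₂ Linked (sym (cycleVertex-even t)) (sym (cycleVertex-odd t))
      (inj₁ (star-edge t<ℓ t<ℓ (Y⊆X t<ℓ)))
  ... | odd {s} s<ℓ with t , refl , s→t ← Next-from-odd {ℓ} {s} next =
    subst₂ Linked (sym (cycleVertex-odd s)) (sym (cycleVertex-even t))
      (inj₂ (star-edge s<ℓ (*-cancelˡ-< 2 t ℓ j<2ℓ) (Y⊆X-next s<ℓ s→t)))

  cycleVertex-induced : i < 2 * ℓ → j < 2 * ℓ → QAdj (cycleVertex i) (cycleVertex j) →
                        Adjacent (2 * ℓ) i j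
  cycleVertex-induced i<2ℓ j<2ℓ adj with position {ℓ = ℓ} i<2ℓ | position {ℓ = ℓ} j<2ℓ
  ... | even {t} t<ℓ | even {u} u<ℓ = ⊥-elim (same-size⇒¬QAdj {p = X t} {X u}
    (trans (∣X∣≡k t<ℓ) (sym (∣X∣≡k u<ℓ)))
    (subst₂ QAdj (cycleVertex-even t) (cycleVertex-even u) adj))
  ... | odd  {s} s<ℓ | odd  {u} u<ℓ = ⊥-elim (same-size⇒¬QAdj {p = Y s} {Y u}
    (suc-injective (trans (1+∣Y∣≡k s<ℓ) (sym (1+∣Y∣≡k u<ℓ))))
    (subst₂ QAdj (cycleVertex-odd s) (cycleVertex-odd u) adj))
  ... | even {t} t<ℓ | odd  {s} s<ℓ =
    QAdj⇒Adjacent t<ℓ s<ℓ (subst₂ QAdj (cycleVertex-even t) (cycleVertex-odd s) adj)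
  ... | odd  {s} s<ℓ | even {t} t<ℓ = swap (QAdj⇒Adjacent t<ℓ s<ℓ
    (QAdj-sym (Y s) (X t) (subst₂ QAdj (cycleVertex-odd s) (cycleVertex-even t) adj)))

  inducedRep : HasInducedRep k (2 * ℓ) (CycleAdj (2 * ℓ))
  inducedRep =
    n , IsCentre , (λ { _ (t , t<ℓ , refl) → ∣X∣≡k t<ℓ }) ,
    (colouring , λ { _ (t , t<ℓ , refl) → X-rainbow t<ℓ }) ,
    cycleVertex ∘ toℕ , toℕ-injective ∘ cycleVertex-injective (toℕ<n _) (toℕ<n _) ,
    cycleVertex-star ∘ toℕ<n , edges , λ i j → cycleVertex-induced (toℕ<n i) (toℕ<n j)
    where
    edges : ∀ i j → CycleAdj (2 * ℓ) i j → Linked (cycleVertex (toℕ i)) (cycleVertex (toℕ j))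
    edges i j (inj₁ next) = cycleVertex-linked (toℕ<n i) (toℕ<n j) next
    edges i j (inj₂ next) = swap (cycleVertex-linked (toℕ<n j) (toℕ<n i) next)

-- Triangles with natural-number labels

-- Membership, containment and bounds are Boolean, so that for literal labels they are
-- decided by evaluation.
_∈₃_ : ℕ → ℕ × ℕ × ℕ → Set
l ∈₃ (a , b , c) = l ≡ a ⊎ l ≡ b ⊎ l ≡ c

_∈ᵇ_ : ℕ → ℕ × ℕ × ℕ → Bool
l ∈ᵇ (a , b , c) = (l ≡ᵇ a) ∨ (l ≡ᵇ b) ∨ (l ≡ᵇ c)

_⊆ᵇ_ : ℕ × ℕ → ℕ × ℕ × ℕ → Bool
(a , b) ⊆ᵇ τ = (a ∈ᵇ τ) ∧ (b ∈ᵇ τ)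

_<ᵇ³_ : ℕ × ℕ × ℕ → ℕ → Bool
(a , b , c) <ᵇ³ n = (a <ᵇ n) ∧ (b <ᵇ n) ∧ (c <ᵇ n)

∈ᵇ⁻ : ∀ l τ → T (l ∈ᵇ τ) → l ∈₃ τ
∈ᵇ⁻ l (a , b , c) = Sum.map (≡ᵇ⇒≡ l a) (Sum.map (≡ᵇ⇒≡ l b) (≡ᵇ⇒≡ l c) ∘ to T-∨) ∘ to T-∨

∈ᵇ⁺ : ∀ {l} τ → l ∈₃ τ → T (l ∈ᵇ τ)
∈ᵇ⁺ {l} (a , b , c) = from T-∨ ∘ Sum.map (≡⇒≡ᵇ l a) (from T-∨ ∘ Sum.map (≡⇒≡ᵇ l b) (≡⇒≡ᵇ l c))

<ᵇ³⁻ : ∀ {a b c} → T ((a , b , c) <ᵇ³ n) → a < n × b < n × c < n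
<ᵇ³⁻ {n} {a} {b} {c} a,b,c<n with to T-∧ a,b,c<n
... | a<n , b,c<n with to T-∧ b,c<n
...   | b<n , c<n = <ᵇ⇒< a n a<n , <ᵇ⇒< b n b<n , <ᵇ⇒< c n c<n

Colourful : (ℕ → Fin 3) → ℕ × ℕ × ℕ → Set
Colourful colour (a , b , c) = Distinct₃ (colour a) (colour b) (colour c)

record TriangleCycle (ℓ n : ℕ) : Set where
  field
    triangle    : ℕ → ℕ × ℕ × ℕ
    edge        : ℕ → ℕ × ℕ
    colour      : ℕ → Fin 3
    bounded     : t < ℓ → T (triangle t <ᵇ³ n)
    colourful   : t < ℓ → Colourful colour (triangle t)
    edge-proper : s < ℓ → proj₁ (edge s) ≢ proj₂ (edge s)
    edge⊆       : s < ℓ → T (edge s ⊆ᵇ triangle s)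
    edge⊆next   : s < ℓ → Next ℓ s t → T (edge s ⊆ᵇ triangle t)
    edge⊆⇒      : s < ℓ → t < ℓ → T (edge s ⊆ᵇ triangle t) → SameOrNext ℓ s t

module _ {ℓ n} .{{_ : NonZero n}} (C : TriangleCycle ℓ n) where
  open TriangleCycle C

  -- labels from n on would wrap around; `bounded` keeps every label below n
  toVertex : ℕ → Fin n
  toVertex l = l mod n

  toℕ-toVertex : ∀ {l} → l < n → toℕ (toVertex l) ≡ l
  toℕ-toVertex l<n = trans (toℕ-fromℕ< _) (m<n⇒m%n≡m l<n)

  toVertex-injective : ∀ {l l′} → l < n → l′ < n → toVertex l ≡ toVertex l′ → l ≡ l′
  toVertex-injective l<n l′<n eq =
    trans (sym (toℕ-toVertex l<n)) (trans (cong toℕ eq) (toℕ-toVertex l′<n))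

  toTriple : ℕ × ℕ × ℕ → Subset n
  toTriple (a , b , c) = triple (toVertex a) (toVertex b) (toVertex c)

  toPair : ℕ × ℕ → Subset n
  toPair (a , b) = pair (toVertex a) (toVertex b)

  colouring : Fin n → Fin 3
  colouring = colour ∘ toℕ

  ∈ᵇ⇒∈ : ∀ {l} τ → T (l ∈ᵇ τ) → toVertex l ∈ toTriple τ
  ∈ᵇ⇒∈ {l} τ =
    ∈-triple⁺ ∘ Sum.map (cong toVertex) (Sum.map (cong toVertex) (cong toVertex)) ∘ ∈ᵇ⁻ l τ

  ∈⇒∈ᵇ : ∀ {l} τ → T (τ <ᵇ³ n) → l < n → toVertex l ∈ toTriple τ → T (l ∈ᵇ τ)
  ∈⇒∈ᵇ τ τ<n l<n with <ᵇ³⁻ τ<n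
  ... | a<n , b<n , c<n = ∈ᵇ⁺ τ ∘ Sum.map (toVertex-injective l<n a<n)
      (Sum.map (toVertex-injective l<n b<n) (toVertex-injective l<n c<n)) ∘ ∈-triple⁻

  ∈ᵇ⇒< : ∀ {l} τ → T (τ <ᵇ³ n) → T (l ∈ᵇ τ) → l < n
  ∈ᵇ⇒< {l} τ τ<n l∈τ with <ᵇ³⁻ τ<n | ∈ᵇ⁻ l τ l∈τ
  ... | a<n , _   , _   | inj₁ refl        = a<n
  ... | _   , b<n , _   | inj₂ (inj₁ refl) = b<n
  ... | _   , _   , c<n | inj₂ (inj₂ refl) = c<n

  ⊆ᵇ⇒⊆ : ∀ e τ → T (e ⊆ᵇ τ) → toPair e ⊆ toTriple τ
  ⊆ᵇ⇒⊆ e τ e⊆τ x∈e with to T-∧ e⊆τ | ∈-pair⁻ x∈e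
  ... | a∈τ , _   | inj₁ refl = ∈ᵇ⇒∈ τ a∈τ
  ... | _   , b∈τ | inj₂ refl = ∈ᵇ⇒∈ τ b∈τ

  ⊆⇒⊆ᵇ : ∀ e τ → T (τ <ᵇ³ n) → proj₁ e < n → proj₂ e < n → toPair e ⊆ toTriple τ → T (e ⊆ᵇ τ)
  ⊆⇒⊆ᵇ e τ τ<n a<n b<n e⊆τ = from T-∧
    (∈⇒∈ᵇ τ τ<n a<n (e⊆τ (∈-pair⁺ (inj₁ refl))) , ∈⇒∈ᵇ τ τ<n b<n (e⊆τ (∈-pair⁺ (inj₂ refl))))

  edge-bounded : s < ℓ → proj₁ (edge s) < n × proj₂ (edge s) < n
  edge-bounded {s} s<ℓ with to T-∧ (edge⊆ s<ℓ)
  ... | a∈τ , b∈τ = ∈ᵇ⇒< (triangle s) (bounded s<ℓ) a∈τ , ∈ᵇ⇒< (triangle s) (bounded s<ℓ) b∈τ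

  triangle-colours : t < ℓ → let (a , b , c) = triangle t in
    Distinct₃ (colouring (toVertex a)) (colouring (toVertex b)) (colouring (toVertex c))
  triangle-colours t<ℓ with <ᵇ³⁻ (bounded t<ℓ)
  ... | a<n , b<n , c<n
    rewrite toℕ-toVertex a<n | toℕ-toVertex b<n | toℕ-toVertex c<n = colourful t<ℓ

  toZigzag : Zigzag 3 ℓ n
  toZigzag = record
    { X         = toTriple ∘ triangle
    ; Y         = toPair ∘ edge
    ; colouring = colouring
    ; ∣X∣≡k     = ∣triple∣≡3 ∘ Distinct₃-preimage colouring ∘ triangle-colours
    ; 1+∣Y∣≡k   = λ s<ℓ → cong suc (∣pair∣≡2 (edge-proper s<ℓ ∘ toVertex-injective
                    (proj₁ (edge-bounded s<ℓ)) (proj₂ (edge-bounded s<ℓ))))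
    ; X-rainbow = triple-rainbow colouring ∘ triangle-colours
    ; Y⊆X       = λ {s} s<ℓ → ⊆ᵇ⇒⊆ (edge s) (triangle s) (edge⊆ s<ℓ)
    ; Y⊆X-next  = λ {s} {t} s<ℓ next → ⊆ᵇ⇒⊆ (edge s) (triangle t) (edge⊆next s<ℓ next)
    ; Y⊆X⇒      = λ {s} {t} s<ℓ t<ℓ Ys⊆Xt → edge⊆⇒ s<ℓ t<ℓ (⊆⇒⊆ᵇ (edge s) (triangle t)
                    (bounded t<ℓ) (proj₁ (edge-bounded s<ℓ)) (proj₂ (edge-bounded s<ℓ)) Ys⊆Xt)
    }

-- Wheels

hub : Fin 3
hub = # 2

rim : Parity → Fin 3
rim 0ℙ = # 0
rim 1ℙ = # 1

colour : ℕ → Fin 3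
colour 0             = hub
colour 1             = hub
colour (suc (suc l)) = rim (parity l)

rim≢hub : ∀ p → rim p ≢ hub
rim≢hub 0ℙ ()
rim≢hub 1ℙ ()

rim-injective : ∀ {p q} → rim p ≡ rim q → p ≡ q
rim-injective {0ℙ} {0ℙ} _ = refl
rim-injective {1ℙ} {1ℙ} _ = refl

parity≢parity-suc : ∀ l → parity l ≢ parity (suc l)
parity≢parity-suc l eq = p≢p⁻¹ (parity (suc l)) (trans (sym eq) (sym (suc-homo-⁻¹ l)))

fan-colourful : ∀ l → Colourful colour (0 , 2 + l , 3 + l)
fan-colourful l =
  rim≢hub (parity l) ∘ sym , rim≢hub (parity (suc l)) ∘ sym , parity≢parity-suc l ∘ rim-injective

-- Hub 0 and rim 2, 3, …, 5 + m; vertex 1 is left unused so that `colour` serves both wheels.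
wheel : ∀ m → parity m ≡ 0ℙ → TriangleCycle (4 + m) (6 + m)
wheel m m-even = record
  { triangle    = triangle
  ; edge        = edge
  ; colour      = colour
  ; bounded     = bounded
  ; colourful   = colourful
  ; edge-proper = λ _ ()
  ; edge⊆       = edge⊆
  ; edge⊆next   = edge⊆next
  ; edge⊆⇒      = edge⊆⇒
  }
  where
  triangle : ℕ → ℕ × ℕ × ℕ
  triangle zero    = 0 , 2 , 5 + m
  triangle (suc t) = 0 , 2 + t , 3 + t

  edge : ℕ → ℕ × ℕ
  edge s = 0 , 2 + s

  bounded : t < 4 + m → T (triangle t <ᵇ³ (6 + m))
  bounded {zero}  _           = <⇒<ᵇ (n<1+n m)
  bounded {suc t} (s≤s t<3+m) = from T-∧ (<⇒<ᵇ (m<n⇒m<1+n t<3+m) , <⇒<ᵇ t<3+m)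

  colourful : t < 4 + m → Colourful colour (triangle t)
  colourful {zero}  _ =
    subst (λ p → Distinct₃ hub (rim p) (rim (parity (suc m)))) m-even (fan-colourful m)
  colourful {suc t} _ = fan-colourful t

  edge⊆ : s < 4 + m → T (edge s ⊆ᵇ triangle s)
  edge⊆ {zero}  _ = _
  edge⊆ {suc s} _ = ∈ᵇ⁺ (triangle (suc s)) (inj₂ (inj₂ refl))

  edge⊆next : s < 4 + m → Next (4 + m) s t → T (edge s ⊆ᵇ triangle t)
  edge⊆next {s} _ (inj₁ refl)          = ∈ᵇ⁺ (triangle (suc s)) (inj₂ (inj₁ refl))
  edge⊆next     _ (inj₂ (refl , refl)) = ∈ᵇ⁺ (triangle 0) (inj₂ (inj₂ refl))

  edge⊆⇒ : s < 4 + m → t < 4 + m → T (edge s ⊆ᵇ triangle t) → SameOrNext (4 + m) s t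
  edge⊆⇒ {zero}  {zero}  _ _ _ = inj₁ refl
  edge⊆⇒ {suc s} {zero}  _ _ p with refl ← ≡ᵇ⇒≡ s (2 + m) p = inj₂ (inj₂ (refl , refl))
  edge⊆⇒ {s}     {suc t} _ _ p with ∈ᵇ⁻ (2 + s) (triangle (suc t)) p
  ... | inj₂ (inj₁ refl) = inj₂ (inj₁ refl)
  ... | inj₂ (inj₂ refl) = inj₁ refl

-- Hub 0 and rim 3, 4, …, 6 + m, with the triangle {0, 3, 4} replaced by the strip
-- {0, 2, 3}, {1, 2, 3}, {1, 3, 4}, {1, 4, 5} around the second hub 1.
gadget-wheel : ∀ m → parity m ≡ 0ℙ → TriangleCycle (7 + m) (7 + m)
gadget-wheel m m-even = record
  { triangle    = triangle
  ; edge        = edge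
  ; colour      = colour
  ; bounded     = bounded
  ; colourful   = colourful
  ; edge-proper = edge-proper
  ; edge⊆       = edge⊆
  ; edge⊆next   = edge⊆next
  ; edge⊆⇒      = edge⊆⇒
  }
  where
  triangle : ℕ → ℕ × ℕ × ℕ
  triangle 0 = 0 , 3 , 6 + m
  triangle 1 = 0 , 2 , 3
  triangle 2 = 1 , 2 , 3
  triangle 3 = 1 , 3 , 4
  triangle 4 = 1 , 4 , 5
  triangle (suc (suc (suc (suc (suc t))))) = 0 , 4 + t , 5 + t

  edge : ℕ → ℕ × ℕ
  edge 0 = 0 , 3
  edge 1 = 2 , 3
  edge 2 = 1 , 3
  edge 3 = 1 , 4
  edge 4 = 4 , 5
  edge (suc (suc (suc (suc (suc s))))) = 0 , 5 + s

  bounded : t < 7 + m → T (triangle t <ᵇ³ (7 + m))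
  bounded {0} _ = <⇒<ᵇ (n<1+n m)
  bounded {1} _ = _
  bounded {2} _ = _
  bounded {3} _ = _
  bounded {4} _ = _
  bounded {suc (suc (suc (suc (suc t))))} (s≤s (s≤s (s≤s (s≤s (s≤s t<2+m))))) =
    from T-∧ (<⇒<ᵇ (m<n⇒m<1+n t<2+m) , <⇒<ᵇ t<2+m)

  colourful : t < 7 + m → Colourful colour (triangle t)
  colourful {0} _ =
    subst (λ p → Distinct₃ hub (rim 1ℙ) (rim p)) (sym m-even) ((λ ()) , (λ ()) , (λ ()))
  colourful {1} _ = (λ ()) , (λ ()) , (λ ())
  colourful {2} _ = (λ ()) , (λ ()) , (λ ())
  colourful {3} _ = (λ ()) , (λ ()) , (λ ())
  colourful {4} _ = (λ ()) , (λ ()) , (λ ())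
  colourful {suc (suc (suc (suc (suc t))))} _ = fan-colourful (2 + t)

  edge-proper : s < 7 + m → proj₁ (edge s) ≢ proj₂ (edge s)
  edge-proper {0} _ ()
  edge-proper {1} _ ()
  edge-proper {2} _ ()
  edge-proper {3} _ ()
  edge-proper {4} _ ()
  edge-proper {suc (suc (suc (suc (suc s))))} _ ()

  edge⊆ : s < 7 + m → T (edge s ⊆ᵇ triangle s)
  edge⊆ {0} _ = _
  edge⊆ {1} _ = _
  edge⊆ {2} _ = _
  edge⊆ {3} _ = _
  edge⊆ {4} _ = _
  edge⊆ {suc (suc (suc (suc (suc s))))} _ = ∈ᵇ⁺ (triangle (5 + s)) (inj₂ (inj₂ refl))

  edge⊆next : s < 7 + m → Next (7 + m) s t → T (edge s ⊆ᵇ triangle t)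
  edge⊆next {0} _ (inj₁ refl) = _
  edge⊆next {1} _ (inj₁ refl) = _
  edge⊆next {2} _ (inj₁ refl) = _
  edge⊆next {3} _ (inj₁ refl) = _
  edge⊆next {4} _ (inj₁ refl) = _
  edge⊆next {suc (suc (suc (suc (suc s))))} _ (inj₁ refl) = ∈ᵇ⁺ (triangle (6 + s)) (inj₂ (inj₁ refl))
  edge⊆next _ (inj₂ (refl , refl)) = ∈ᵇ⁺ (triangle 0) (inj₂ (inj₂ refl))

  edge⊆⇒ : s < 7 + m → t < 7 + m → T (edge s ⊆ᵇ triangle t) → SameOrNext (7 + m) s t
  edge⊆⇒ {0} {0} _ _ _  = inj₁ refl
  edge⊆⇒ {0} {1} _ _ _  = inj₂ (inj₁ refl)
  edge⊆⇒ {0} {2} _ _ ()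
  edge⊆⇒ {0} {3} _ _ ()
  edge⊆⇒ {0} {4} _ _ ()
  edge⊆⇒ {0} {suc (suc (suc (suc (suc t))))} _ _ ()
  edge⊆⇒ {1} {0} _ _ ()
  edge⊆⇒ {1} {1} _ _ _  = inj₁ refl
  edge⊆⇒ {1} {2} _ _ _  = inj₂ (inj₁ refl)
  edge⊆⇒ {1} {3} _ _ ()
  edge⊆⇒ {1} {4} _ _ ()
  edge⊆⇒ {1} {suc (suc (suc (suc (suc t))))} _ _ ()
  edge⊆⇒ {2} {0} _ _ ()
  edge⊆⇒ {2} {1} _ _ ()
  edge⊆⇒ {2} {2} _ _ _  = inj₁ refl
  edge⊆⇒ {2} {3} _ _ _  = inj₂ (inj₁ refl)
  edge⊆⇒ {2} {4} _ _ ()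
  edge⊆⇒ {2} {suc (suc (suc (suc (suc t))))} _ _ ()
  edge⊆⇒ {3} {0} _ _ ()
  edge⊆⇒ {3} {1} _ _ ()
  edge⊆⇒ {3} {2} _ _ ()
  edge⊆⇒ {3} {3} _ _ _  = inj₁ refl
  edge⊆⇒ {3} {4} _ _ _  = inj₂ (inj₁ refl)
  edge⊆⇒ {3} {suc (suc (suc (suc (suc t))))} _ _ ()
  edge⊆⇒ {4} {0} _ _ ()
  edge⊆⇒ {4} {1} _ _ ()
  edge⊆⇒ {4} {2} _ _ ()
  edge⊆⇒ {4} {3} _ _ ()
  edge⊆⇒ {4} {4} _ _ _  = inj₁ refl
  edge⊆⇒ {4} {5} _ _ _  = inj₂ (inj₁ refl)
  edge⊆⇒ {4} {suc (suc (suc (suc (suc (suc t)))))} _ _ ()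
  edge⊆⇒ {suc (suc (suc (suc (suc s))))} {0} _ _ p with refl ← ≡ᵇ⇒≡ s (suc m) p =
    inj₂ (inj₂ (refl , refl))
  edge⊆⇒ {suc (suc (suc (suc (suc s))))} {1} _ _ ()
  edge⊆⇒ {suc (suc (suc (suc (suc s))))} {2} _ _ ()
  edge⊆⇒ {suc (suc (suc (suc (suc s))))} {3} _ _ ()
  edge⊆⇒ {suc (suc (suc (suc (suc s))))} {4} _ _ ()
  edge⊆⇒ {suc (suc (suc (suc (suc s))))} {suc (suc (suc (suc (suc t))))} _ _ p
    with ∈ᵇ⁻ (5 + s) (triangle (5 + t)) p
  ... | inj₂ (inj₁ refl) = inj₂ (inj₁ refl)
  ... | inj₂ (inj₂ refl) = inj₁ refl

data AdmissibleLength : ℕ → Set where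
  wheel-length  : ∀ m → parity m ≡ 0ℙ → AdmissibleLength (4 + m)
  gadget-length : ∀ m → parity m ≡ 0ℙ → AdmissibleLength (7 + m)

admissible : ∀ ℓ → 2 * ℓ ≡ 8 ⊎ 12 ≤ 2 * ℓ → AdmissibleLength ℓ
admissible ℓ (inj₁ 2ℓ≡8) with refl ← *-cancelˡ-≡ ℓ 4 2 2ℓ≡8 = wheel-length 0 refl
admissible ℓ (inj₂ 12≤2ℓ) with m , refl ← m≤n⇒∃[o]m+o≡n (*-cancelˡ-≤ {6} {ℓ} 2 12≤2ℓ) =
  at-least-six m
  where
  at-least-six : ∀ m → AdmissibleLength (6 + m)
  at-least-six zero = wheel-length 2 refl
  at-least-six (suc m) with parity m in m-parity
  ... | 0ℙ = gadget-length m m-parity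
  ... | 1ℙ = wheel-length (3 + m) (sym (⁻¹-selfInverse (trans (suc-homo-⁻¹ m) m-parity)))

lemmaA2 : (ℓ : ℕ) → (2 * ℓ ≡ 8 ⊎ 12 ≤ 2 * ℓ) →
    HasInducedRep 3 (2 * ℓ) (CycleAdj (2 * ℓ)) ⊎ HasInducedRep 2 (2 * ℓ) (CycleAdj (2 * ℓ))
lemmaA2 ℓ bound with admissible ℓ bound
... | wheel-length m m-even =
  inj₁ (inducedRep (toZigzag (wheel m m-even)) (s≤s (s≤s (s≤s z≤n))))
... | gadget-length m m-even =
  inj₁ (inducedRep (toZigzag (gadget-wheel m m-even)) (s≤s (s≤s (s≤s z≤n))))
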